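{- Let $\phi$ be a tree-compatible endomorphism of $D_E\otimes D_V$ and $\phi'$ a tree-compatible endomorphism of $D'_E\otimes D'_V$. Then the endomorphism $\Phi$ of $(D_E\otimes D'_E)\otimes(D_V\otimes D'_V)$ given, in Sweedler notation, by $\Phi(a\otimes a'\otimes b\otimes b')=\sum_i\sum_j\phi_E^i(a)\otimes\phi'^j_E(a')\otimes\phi_V^i(b)\otimes\phi'^j_V(b')$ (that is, $\Phi=\phi_{13}\circ\phi'_{24}$), is tree-compatible (with $D_E\otimes D'_E$ as edge space and $D_V\otimes D'_V$ as vertex space).
   Context: $\mathbb{K}$ is a field of characteristic zero. Sweedler notation: $\phi(a\otimes b)=\sum_i\phi^i_E(a)\otimes\phi^i_V(b)$. For vector spaces $D_E,D_V$ and a linear $\phi:D_E\otimes D_V\to D_E\otimes D_V$, with $\tau$ the flip of $D_E\otimes D_E$, define on $D_E\otimes D_E\otimes D_V$: $\phi_{23}=\mathrm{Id}_{D_E}\otimes\phi$ and $\phi_{13}=(\tau\otimes\mathrm{Id}_{D_V})\circ(\mathrm{Id}_{D_E}\otimes\phi)\circ(\tau\otimes\mathrm{Id}_{D_V})$. $\phi$ is tree-compatible if $\phi_{13}\circ\phi_{23}=\phi_{23}\circ\phi_{13}$, i.e. $\sum_{i,j}\phi^i_E(a)\otimes\phi^j_E(a')\otimes\phi^i_V\phi^j_V(b)=\sum_{i,j}\phi^i_E(a)\otimes\phi^j_E(a')\otimes\phi^j_V\phi^i_V(b)$ for all $a,a',b$. -}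

module Defs where

open import Level using (Level; _⊔_)
open import Data.Nat using (ℕ; zero; suc)
open import Data.Product using (_×_; _,_; ∃)
open import Data.List using (List; []; _∷_; [_]; _++_; map; concatMap)
open import Relation.Nullary using (¬_)
open import Algebra.Bundles using (CommutativeRing)
open import Algebra.Module.Bundles using (Module)

module _ {r ℓr} (K : CommutativeRing r ℓr) where
  open CommutativeRing K

  natToK : ℕ → Carrier
  natToK zero    = 0#
  natToK (suc n) = 1# + natToK n

  record IsFieldChar0 : Set (r ⊔ ℓr) where
    field
      nontrivial : ¬ (1# ≈ 0#)
      inverse    : ∀ x → ¬ (x ≈ 0#) → ∃ λ y → (x * y) ≈ 1#
      char0      : ∀ n → ¬ (natToK (suc n) ≈ 0#)

-- Raw "spaces": the data (carrier, equality, +, 0, scalar action) needed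
-- to form tensor products.  Genuine vector spaces enter as K-modules
-- (see toSpace); tensor products of those are again (laws unrecorded)
-- vector spaces, presented as formal sums modulo the tensor relations.

module _ {r ℓr} (K : CommutativeRing r ℓr) where
  private module K = CommutativeRing K

  record Space (a ℓ : Level) : Set (r ⊔ Level.suc (a ⊔ ℓ)) where
    field
      Carrier : Set a
      _≈_     : Carrier → Carrier → Set ℓ
      _+_     : Carrier → Carrier → Carrier
      0#      : Carrier
      _·_     : K.Carrier → Carrier → Carrier

  toSpace : ∀ {m ℓm} → Module K m ℓm → Space m ℓm
  toSpace M = record
    { Carrier = M.Carrierᴹ ; _≈_ = M._≈ᴹ_ ; _+_ = M._+ᴹ_ ; 0# = M.0ᴹ ; _·_ = M._*ₗ_ }
    where module M = Module M

  -- Tensor product M ⊗ N: finite formal sums of pure tensors m ⊗ n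
  -- (lists of pairs), modulo the congruence generated by commutativity
  -- of + and the bilinearity relations.
  module TensorRel {a ℓ ℓ'} (M : Space a ℓ) (N : Space a ℓ') where
    private
      module M = Space M
      module N = Space N

    Elt : Set a
    Elt = List (M.Carrier × N.Carrier)

    infix 4 _∼_
    data _∼_ : Elt → Elt → Set (r ⊔ a ⊔ ℓ ⊔ ℓ') where
      ∼-refl   : ∀ {xs} → xs ∼ xs
      ∼-sym    : ∀ {xs ys} → xs ∼ ys → ys ∼ xs
      ∼-trans  : ∀ {xs ys zs} → xs ∼ ys → ys ∼ zs → xs ∼ zs
      ++-cong  : ∀ {xs xs' ys ys'} → xs ∼ xs' → ys ∼ ys' → xs ++ ys ∼ xs' ++ ys'
      ++-comm  : ∀ xs ys → xs ++ ys ∼ ys ++ xs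
      pure-cong : ∀ {m m' n n'} → m M.≈ m' → n N.≈ n' → [ (m , n) ] ∼ [ (m' , n') ]
      addˡ     : ∀ m m' n → [ (m M.+ m' , n) ] ∼ (m , n) ∷ [ (m' , n) ]
      addʳ     : ∀ m n n' → [ (m , n N.+ n') ] ∼ (m , n) ∷ [ (m , n') ]
      smul     : ∀ (c : K.Carrier) m n → [ (c M.· m , n) ] ∼ [ (m , c N.· n) ]
      zeroˡ    : ∀ n → [ (M.0# , n) ] ∼ []

  _⊗_ : ∀ {a ℓ ℓ'} → Space a ℓ → Space a ℓ' → Space a (r ⊔ a ⊔ ℓ ⊔ ℓ')
  M ⊗ N = record
    { Carrier = Elt
    ; _≈_ = _∼_
    ; _+_ = _++_
    ; 0# = []
    ; _·_ = λ c → map (λ { (m , n) → (c M.· m , n) })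
    }
    where
      open TensorRel M N
      module M = Space M

  record IsLinear {a ℓ} (W : Space a ℓ) (f : Space.Carrier W → Space.Carrier W)
         : Set (r ⊔ a ⊔ ℓ) where
    open Space W
    field
      cong     : ∀ {x y} → x ≈ y → f x ≈ f y
      additive : ∀ x y → f (x + y) ≈ (f x + f y)
      homog    : ∀ c x → f (c · x) ≈ (c · f x)

  record LinEnd {a ℓ} (W : Space a ℓ) : Set (r ⊔ a ⊔ ℓ) where
    field
      fun    : Space.Carrier W → Space.Carrier W
      linear : IsLinear W fun

  module _ {a ℓ} {E V : Space a ℓ} where
    idTensor : ∀ {ℓw} {W : Space a ℓw} →
               (Space.Carrier W → Space.Carrier W) →
               Space.Carrier (E ⊗ W) → Space.Carrier (E ⊗ W)
    idTensor f = concatMap (λ { (x , w) → [ (x , f w) ] })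

    -- τ ⊗ Id on  D_E ⊗ D_E ⊗ D_V  (modelled as D_E ⊗ (D_E ⊗ D_V)):
    -- a ⊗ (a' ⊗ b) ↦ a' ⊗ (a ⊗ b)
    flip13 : Space.Carrier (E ⊗ (E ⊗ V)) → Space.Carrier (E ⊗ (E ⊗ V))
    flip13 = concatMap (λ { (x , ys) → map (λ { (x' , b) → (x' , [ (x , b) ]) }) ys })

    φ₂₃ : (Space.Carrier (E ⊗ V) → Space.Carrier (E ⊗ V)) →
          Space.Carrier (E ⊗ (E ⊗ V)) → Space.Carrier (E ⊗ (E ⊗ V))
    φ₂₃ φ = idTensor {W = E ⊗ V} φ

    φ₁₃ : (Space.Carrier (E ⊗ V) → Space.Carrier (E ⊗ V)) →
          Space.Carrier (E ⊗ (E ⊗ V)) → Space.Carrier (E ⊗ (E ⊗ V))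
    φ₁₃ φ t = flip13 (φ₂₃ φ (flip13 t))

  -- Tree-compatibility: φ₁₃ ∘ φ₂₃ = φ₂₃ ∘ φ₁₃ on D_E ⊗ D_E ⊗ D_V.
  -- (stated for the underlying function; applied to linear maps)
  TreeCompatible : ∀ {a ℓ} (E V : Space a ℓ) →
                   (Space.Carrier (E ⊗ V) → Space.Carrier (E ⊗ V)) → Set (r ⊔ a ⊔ ℓ)
  TreeCompatible E V φ =
    ∀ t → Space._≈_ (E ⊗ (E ⊗ V)) (φ₁₃ {E = E} {V} φ (φ₂₃ {E = E} {V} φ t)) (φ₂₃ {E = E} {V} φ (φ₁₃ {E = E} {V} φ t))

  -- The map Φ on (E ⊗ E') ⊗ (V ⊗ V'):
  -- (a ⊗ a') ⊗ (b ⊗ b') ↦ Σᵢ Σⱼ (φᴱⁱ(a) ⊗ φ'ᴱʲ(a')) ⊗ (φⱽⁱ(b) ⊗ φ'ⱽʲ(b')),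
  -- extended additively to formal sums.
  module _ {a ℓ} {E V E' V' : Space a ℓ} where
    ΦFun : LinEnd (E ⊗ V) → LinEnd (E' ⊗ V') →
           Space.Carrier ((E ⊗ E') ⊗ (V ⊗ V')) → Space.Carrier ((E ⊗ E') ⊗ (V ⊗ V'))
    ΦFun φ φ' = concatMap λ { (es , vs) →
      concatMap (λ { (x , x') → concatMap (λ { (b , b') →
        concatMap (λ { (p , q) →
          map (λ { (p' , q') → ([ (p , p') ] , [ (q , q') ]) })
              (LinEnd.fun φ' [ (x' , b') ]) })
          (LinEnd.fun φ [ (x , b) ]) }) vs }) es }

-- Every tensor is a finite formal sum of pure tensors and both composites in the
-- tree-compatibility equation are additive, so it suffices to compare them on tensors
-- e ⊗ ((a₂ ⊗ a₂') ⊗ (b ⊗ b')).  Reordering the finite sums, φ₁₃ ∘ φ₂₃ for Φ becomes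
--   Σ_{a ⊗ a' ∈ e} (φ₁₃ ∘ φ₂₃)(a ⊗ a₂ ⊗ b) ⊠₃ (φ'₁₃ ∘ φ'₂₃)(a' ⊗ a₂' ⊗ b'),
-- where ⊠₃ interleaves the factors of two three-fold tensors, and likewise for φ₂₃ ∘ φ₁₃.
-- Since ⊠₃ respects the tensor relations, the hypotheses on φ and φ' identify the two
-- expansions.  Linearity of Φ holds because its formula on generators is balanced in each
-- tensor factor.
module Submission where

open import Defs
open import Level using (Level; _⊔_)
open import Function using (_∘_)
open import Data.Product using (_×_; _,_)
open import Data.List using (List; []; _∷_; [_]; _++_; map; concatMap)
open import Data.List.Properties
  using (++-assoc; ++-identityʳ; concatMap-cong; concatMap-++; concatMap-map; map-concatMap; map-++; map-∘)
open import Relation.Binary.Core using (Rel; _Preserves₂_⟶_⟶_)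
open import Relation.Binary.Structures using (IsEquivalence)
open import Relation.Binary.PropositionalEquality using (_≡_; refl; sym; trans; cong; cong₂; module ≡-Reasoning)
open import Algebra.Bundles using (CommutativeRing; CommutativeMonoid)
open import Algebra.Module.Bundles using (Module)
import Algebra.Definitions as AlgebraDefinitions
import Algebra.Properties.CommutativeSemigroup as CommutativeSemigroupProperties
import Relation.Binary.Reasoning.Setoid as SetoidReasoning

concatMap-concatMap : ∀ {a b c} {A : Set a} {B : Set b} {C : Set c} (g : B → List C) (f : A → List B) xs →
  concatMap g (concatMap f xs) ≡ concatMap (concatMap g ∘ f) xs
concatMap-concatMap g f []       = refl
concatMap-concatMap g f (x ∷ xs) =
  trans (concatMap-++ g (f x) (concatMap f xs)) (cong (concatMap g (f x) ++_) (concatMap-concatMap g f xs))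

module _ {a b c} {A : Set a} {B : Set b} {C : Set c} where

  productWith : (A → B → C) → List A → List B → List C
  productWith h xs ys = concatMap (λ x → map (h x) ys) xs

  productWith-distribʳ-++ : ∀ (h : A → B → C) xs₁ xs₂ ys →
    productWith h (xs₁ ++ xs₂) ys ≡ productWith h xs₁ ys ++ productWith h xs₂ ys
  productWith-distribʳ-++ h xs₁ xs₂ ys = concatMap-++ (λ x → map (h x) ys) xs₁ xs₂

  concatMap-productWith : ∀ {d} {D : Set d} (k : C → List D) (h : A → B → C) xs ys →
    concatMap k (productWith h xs ys) ≡ concatMap (λ x → concatMap (λ y → k (h x y)) ys) xs
  concatMap-productWith k h xs ys =
    trans (concatMap-concatMap k _ xs) (concatMap-cong (λ x → concatMap-map k (h x) ys) xs)

module _ {a b} {A : Set a} {B : Set b} where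
  map-as-concatMap : (f : A → B) (xs : List A) → map f xs ≡ concatMap ([_] ∘ f) xs
  map-as-concatMap f []       = refl
  map-as-concatMap f (x ∷ xs) = cong (f x ∷_) (map-as-concatMap f xs)

module _ {a b c d} {A : Set a} {B : Set b} {C : Set c} {D : Set d} where
  map-productWith : (k : C → D) (h : A → B → C) (xs : List A) (ys : List B) →
    map k (productWith h xs ys) ≡ productWith (λ x y → k (h x y)) xs ys
  map-productWith k h xs ys =
    trans (map-concatMap k _ xs) (concatMap-cong (λ x → sym (map-∘ ys)) xs)

module _ {a b a' b' c} {A : Set a} {B : Set b} {A' : Set a'} {B' : Set b'} {C : Set c} where
  productWith-map : (h : A' → B' → C) (f : A → A') (g : B → B') (xs : List A) (ys : List B) →
    productWith h (map f xs) (map g ys) ≡ productWith (λ x y → h (f x) (g y)) xs ys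
  productWith-map h f g xs ys =
    trans (concatMap-map _ f xs) (concatMap-cong (λ x → sym (map-∘ ys)) xs)

record CommutativeListCongruence {a} (A : Set a) (ℓ : Level) : Set (a ⊔ Level.suc ℓ) where
  infix 4 _≋_
  field
    _≋_           : Rel (List A) ℓ
    isEquivalence : IsEquivalence _≋_
    ++⁺           : _++_ Preserves₂ _≋_ ⟶ _≋_ ⟶ _≋_
    comm          : AlgebraDefinitions.Commutative _≋_ _++_

module CommutativeListCongruenceProperties {a ℓ} {A : Set a} (C : CommutativeListCongruence A ℓ) where
  open CommutativeListCongruence C public
  open IsEquivalence isEquivalence public
    renaming (refl to ≋-refl; sym to ≋-sym; trans to ≋-trans; reflexive to ≡⇒≋)

  commutativeMonoid : CommutativeMonoid a ℓ
  commutativeMonoid = record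
    { Carrier = List A ; _≈_ = _≋_ ; _∙_ = _++_ ; ε = []
    ; isCommutativeMonoid = record
      { isMonoid = record
        { isSemigroup = record
          { isMagma = record { isEquivalence = isEquivalence ; ∙-cong = ++⁺ }
          ; assoc = λ xs ys zs → ≡⇒≋ (++-assoc xs ys zs) }
        ; identity = (λ _ → ≋-refl) , (λ xs → ≡⇒≋ (++-identityʳ xs)) }
      ; comm = comm } }

  open CommutativeSemigroupProperties (CommutativeMonoid.commutativeSemigroup commutativeMonoid)
    using (interchange)
  module ≋-Reasoning = SetoidReasoning (CommutativeMonoid.setoid commutativeMonoid)

  module _ {b} {B : Set b} where
    concatMap⁺ : {f g : B → List A} → (∀ x → f x ≋ g x) → ∀ xs → concatMap f xs ≋ concatMap g xs
    concatMap⁺ f≋g []       = ≋-refl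
    concatMap⁺ f≋g (x ∷ xs) = ++⁺ (f≋g x) (concatMap⁺ f≋g xs)

    concatMap-≋[] : {f : B → List A} → (∀ x → f x ≋ []) → ∀ xs → concatMap f xs ≋ []
    concatMap-≋[] f≋[] []       = ≋-refl
    concatMap-≋[] f≋[] (x ∷ xs) = ++⁺ (f≋[] x) (concatMap-≋[] f≋[] xs)

    concatMap-distrib : {f g h : B → List A} → (∀ x → f x ≋ g x ++ h x) →
      ∀ xs → concatMap f xs ≋ concatMap g xs ++ concatMap h xs
    concatMap-distrib f≋g+h []       = ≋-refl
    concatMap-distrib {g = g} {h} f≋g+h (x ∷ xs) =
      ≋-trans (++⁺ (f≋g+h x) (concatMap-distrib f≋g+h xs))
              (interchange (g x) (h x) (concatMap g xs) (concatMap h xs))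

    map⁺ : {f g : B → A} → (∀ x → [ f x ] ≋ [ g x ]) → ∀ xs → map f xs ≋ map g xs
    map⁺ f≋g []       = ≋-refl
    map⁺ f≋g (x ∷ xs) = ++⁺ (f≋g x) (map⁺ f≋g xs)

    map-≋[] : {f : B → A} → (∀ x → [ f x ] ≋ []) → ∀ xs → map f xs ≋ []
    map-≋[] f≋[] []       = ≋-refl
    map-≋[] f≋[] (x ∷ xs) = ++⁺ (f≋[] x) (map-≋[] f≋[] xs)

    map-distrib : {f g h : B → A} → (∀ x → [ f x ] ≋ [ g x ] ++ [ h x ]) →
      ∀ xs → map f xs ≋ map g xs ++ map h xs
    map-distrib f≋g+h []       = ≋-refl
    map-distrib {g = g} {h} f≋g+h (x ∷ xs) =
      ≋-trans (++⁺ (f≋g+h x) (map-distrib f≋g+h xs))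
              (interchange [ g x ] [ h x ] (map g xs) (map h xs))

  concatMap-comm : ∀ {b c} {B : Set b} {D : Set c} (f : B → D → List A) xs ys →
    concatMap (λ x → concatMap (f x) ys) xs ≋ concatMap (λ y → concatMap (λ x → f x y) xs) ys
  concatMap-comm f []       ys = ≋-sym (concatMap-≋[] (λ _ → ≋-refl) ys)
  concatMap-comm f (x ∷ xs) ys =
    ≋-trans (++⁺ ≋-refl (concatMap-comm f xs ys)) (≋-sym (concatMap-distrib (λ _ → ≋-refl) ys))

  module _ {b c} {B : Set b} {D : Set c} (h : B → D → A) where
    productWith-distribˡ-++ : ∀ xs ys₁ ys₂ →
      productWith h xs (ys₁ ++ ys₂) ≋ productWith h xs ys₁ ++ productWith h xs ys₂
    productWith-distribˡ-++ xs ys₁ ys₂ = concatMap-distrib (λ x → ≡⇒≋ (map-++ (h x) ys₁ ys₂)) xs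

    productWith-concatMap : ∀ {b' c'} {B' : Set b'} {D' : Set c'} (f : B' → List B) (g : D' → List D) xs ys →
      productWith h (concatMap f xs) (concatMap g ys) ≋
      concatMap (λ x → concatMap (λ y → productWith h (f x) (g y)) ys) xs
    productWith-concatMap f g xs ys = begin
      productWith h (concatMap f xs) (concatMap g ys)
        ≡⟨ concatMap-concatMap _ f xs ⟩
      concatMap (λ x → concatMap (λ u → map (h u) (concatMap g ys)) (f x)) xs
        ≡⟨ concatMap-cong (λ x → concatMap-cong (λ u → map-concatMap (h u) g ys) (f x)) xs ⟩
      concatMap (λ x → concatMap (λ u → concatMap (λ y → map (h u) (g y)) ys) (f x)) xs
        ≈⟨ concatMap⁺ (λ x → concatMap-comm (λ u y → map (h u) (g y)) (f x) ys) xs ⟩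
      concatMap (λ x → concatMap (λ y → productWith h (f x) (g y)) ys) xs ∎
      where open ≋-Reasoning

    productWith-split : ∀ {e} {Z : Set e} (k : Z → B → D → A) zs →
      (∀ x y → [ h x y ] ≋ concatMap (λ z → [ k z x y ]) zs) →
      ∀ xs ys → productWith h xs ys ≋ concatMap (λ z → productWith (k z) xs ys) zs
    productWith-split k zs h≋k xs ys = begin
      concatMap (λ x → map (h x) ys) xs
        ≡⟨ concatMap-cong (λ x → map-as-concatMap (h x) ys) xs ⟩
      concatMap (λ x → concatMap (λ y → [ h x y ]) ys) xs
        ≈⟨ concatMap⁺ (λ x → concatMap⁺ (h≋k x) ys) xs ⟩
      concatMap (λ x → concatMap (λ y → concatMap (λ z → [ k z x y ]) zs) ys) xs
        ≈⟨ concatMap⁺ (λ x → concatMap-comm (λ y z → [ k z x y ]) ys zs) xs ⟩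
      concatMap (λ x → concatMap (λ z → concatMap (λ y → [ k z x y ]) ys) zs) xs
        ≈⟨ concatMap-comm (λ x z → concatMap (λ y → [ k z x y ]) ys) xs zs ⟩
      concatMap (λ z → concatMap (λ x → concatMap (λ y → [ k z x y ]) ys) xs) zs
        ≡⟨ concatMap-cong (λ z → concatMap-cong (λ x → map-as-concatMap (k z x) ys) xs) zs ⟨
      concatMap (λ z → productWith (k z) xs ys) zs ∎
      where open ≋-Reasoning

module _ {r ℓr} (K : CommutativeRing r ℓr) where
  ⊗-congruence : ∀ {a ℓ ℓ'} (M : Space K a ℓ) (N : Space K a ℓ') →
    CommutativeListCongruence (Space.Carrier M × Space.Carrier N) (r ⊔ a ⊔ ℓ ⊔ ℓ')
  ⊗-congruence M N = record
    { _≋_ = _∼_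
    ; isEquivalence = record { refl = ∼-refl ; sym = ∼-sym ; trans = ∼-trans }
    ; ++⁺ = ++-cong
    ; comm = ++-comm
    }
    where open TensorRel K M N

  module _ {a ℓ ℓ' c ℓc} (M : Space K a ℓ) (N : Space K a ℓ') {A : Set c}
           (C : CommutativeListCongruence A ℓc) where
    private
      module M = Space M
      module N = Space N
    open CommutativeListCongruenceProperties C
    open TensorRel K M N

    record Balanced (f : M.Carrier × N.Carrier → List A) : Set (r ⊔ a ⊔ ℓ ⊔ ℓ' ⊔ ℓc) where
      field
        resp-≈ : ∀ {m m' n n'} → m M.≈ m' → n N.≈ n' → f (m , n) ≋ f (m' , n')
        +ˡ     : ∀ m m' n → f (m M.+ m' , n) ≋ f (m , n) ++ f (m' , n)
        +ʳ     : ∀ m n n' → f (m , n N.+ n') ≋ f (m , n) ++ f (m , n')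
        ·-mid  : ∀ c m n → f (c M.· m , n) ≋ f (m , c N.· n)
        0ˡ     : ∀ n → f (M.0# , n) ≋ []

    concatMap-resp-∼ : ∀ {f} → Balanced f → ∀ {xs ys} → xs ∼ ys → concatMap f xs ≋ concatMap f ys
    concatMap-resp-∼ B ∼-refl        = ≋-refl
    concatMap-resp-∼ B (∼-sym p)     = ≋-sym (concatMap-resp-∼ B p)
    concatMap-resp-∼ B (∼-trans p q) = ≋-trans (concatMap-resp-∼ B p) (concatMap-resp-∼ B q)
    concatMap-resp-∼ {f} B (++-cong {xs} {xs'} {ys} {ys'} p q) = begin
      concatMap f (xs ++ ys)               ≡⟨ concatMap-++ f xs ys ⟩
      concatMap f xs ++ concatMap f ys     ≈⟨ ++⁺ (concatMap-resp-∼ B p) (concatMap-resp-∼ B q) ⟩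
      concatMap f xs' ++ concatMap f ys'   ≡⟨ concatMap-++ f xs' ys' ⟨
      concatMap f (xs' ++ ys')             ∎
      where open ≋-Reasoning
    concatMap-resp-∼ {f} B (++-comm xs ys) = begin
      concatMap f (xs ++ ys)               ≡⟨ concatMap-++ f xs ys ⟩
      concatMap f xs ++ concatMap f ys     ≈⟨ comm (concatMap f xs) (concatMap f ys) ⟩
      concatMap f ys ++ concatMap f xs     ≡⟨ concatMap-++ f ys xs ⟨
      concatMap f (ys ++ xs)               ∎
      where open ≋-Reasoning
    concatMap-resp-∼ B (pure-cong p q) = ++⁺ (Balanced.resp-≈ B p q) ≋-refl
    concatMap-resp-∼ {f} B (addˡ m m' n) =
      ≋-trans (≡⇒≋ (++-identityʳ (f (m M.+ m' , n))))
        (≋-trans (Balanced.+ˡ B m m' n) (++⁺ ≋-refl (≡⇒≋ (sym (++-identityʳ (f (m' , n)))))))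
    concatMap-resp-∼ {f} B (addʳ m n n') =
      ≋-trans (≡⇒≋ (++-identityʳ (f (m , n N.+ n'))))
        (≋-trans (Balanced.+ʳ B m n n') (++⁺ ≋-refl (≡⇒≋ (sym (++-identityʳ (f (m , n')))))))
    concatMap-resp-∼ B (smul c m n) = ++⁺ (Balanced.·-mid B c m n) ≋-refl
    concatMap-resp-∼ {f} B (zeroˡ n) = ≋-trans (≡⇒≋ (++-identityʳ (f (M.0# , n)))) (Balanced.0ˡ B n)

module ModuleTensor {r ℓr m ℓm} (K : CommutativeRing r ℓr) (M N : Module K m ℓm) where
  private
    module K = CommutativeRing K
    module M = Module M
    module N = Module N
    MN = _⊗_ K (toSpace K M) (toSpace K N)
  open TensorRel K (toSpace K M) (toSpace K N)
  open CommutativeListCongruenceProperties (⊗-congruence K (toSpace K M) (toSpace K N))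
    using (map-≋[])

  ⊗-zeroʳ : ∀ p → [ (p , N.0ᴹ) ] ∼ []
  ⊗-zeroʳ p =
    ∼-trans (pure-cong M.≈ᴹ-refl (N.≈ᴹ-sym (N.*ₗ-zeroˡ N.0ᴹ)))
      (∼-trans (∼-sym (smul K.0# p N.0ᴹ)) (∼-trans (pure-cong (M.*ₗ-zeroˡ p) N.≈ᴹ-refl) (zeroˡ N.0ᴹ)))

  ·-zeroˡ : ∀ xs → Space._·_ MN K.0# xs ∼ []
  ·-zeroˡ = map-≋[] λ (p , q) → ∼-trans (pure-cong (M.*ₗ-zeroˡ p) N.≈ᴹ-refl) (zeroˡ q)

  module OnPureTensors (φ : LinEnd K MN) where
    open LinEnd φ
    private module φ = IsLinear linear

    F : M.Carrierᴹ → N.Carrierᴹ → Elt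
    F p q = fun [ (p , q) ]

    fun-[] : fun [] ∼ []
    fun-[] = ∼-trans (φ.homog K.0# []) (·-zeroˡ (fun []))

    F-resp-≈ : ∀ {p p' q q'} → p M.≈ᴹ p' → q N.≈ᴹ q' → F p q ∼ F p' q'
    F-resp-≈ p≈p' q≈q' = φ.cong (pure-cong p≈p' q≈q')

    F-+ˡ : ∀ p p' q → F (p M.+ᴹ p') q ∼ F p q ++ F p' q
    F-+ˡ p p' q = ∼-trans (φ.cong (addˡ p p' q)) (φ.additive [ (p , q) ] [ (p' , q) ])

    F-+ʳ : ∀ p q q' → F p (q N.+ᴹ q') ∼ F p q ++ F p q'
    F-+ʳ p q q' = ∼-trans (φ.cong (addʳ p q q')) (φ.additive [ (p , q) ] [ (p , q') ])

    F-·ˡ : ∀ c p q → F (c M.*ₗ p) q ∼ Space._·_ MN c (F p q)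
    F-·ˡ c p q = φ.homog c [ (p , q) ]

    F-·ʳ : ∀ c p q → F p (c N.*ₗ q) ∼ Space._·_ MN c (F p q)
    F-·ʳ c p q = ∼-trans (φ.cong (∼-sym (smul c p q))) (φ.homog c [ (p , q) ])

    F-0ˡ : ∀ q → F M.0ᴹ q ∼ []
    F-0ˡ q = ∼-trans (φ.cong (zeroˡ q)) fun-[]

    F-0ʳ : ∀ p → F p N.0ᴹ ∼ []
    F-0ʳ p = ∼-trans (φ.cong (⊗-zeroʳ p)) fun-[]

module TreeCompatibility {r ℓr a ℓ} (K : CommutativeRing r ℓr) (E V : Space K a ℓ)
  (φ : List (Space.Carrier E × Space.Carrier V) → List (Space.Carrier E × Space.Carrier V)) where
  private
    module E = Space E
    module V = Space V
    EV = _⊗_ K E V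
    module EV = TensorRel K E V
    module EEV = CommutativeListCongruenceProperties (⊗-congruence K E EV)
  open EEV using (_≋_)

  flipped : E.Carrier → E.Carrier × V.Carrier → E.Carrier × EV.Elt
  flipped x (x' , b) = (x' , [ (x , b) ])

  φ₂₃-flipped : E.Carrier → E.Carrier × V.Carrier → E.Carrier × EV.Elt
  φ₂₃-flipped x (x' , b) = (x' , φ [ (x , b) ])

  φ₁₃-pure : E.Carrier → E.Carrier × V.Carrier → List (E.Carrier × EV.Elt)
  φ₁₃-pure e (x , b) = map (flipped x) (φ [ (e , b) ])

  φ₂₃φ₁₃-pure : E.Carrier → E.Carrier × V.Carrier → List (E.Carrier × EV.Elt)
  φ₂₃φ₁₃-pure e (x , b) = map (φ₂₃-flipped x) (φ [ (e , b) ])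

  φ₁₃φ₂₃ : E.Carrier → EV.Elt → List (E.Carrier × EV.Elt)
  φ₁₃φ₂₃ e ys = concatMap (φ₁₃-pure e) (φ ys)

  φ₂₃φ₁₃ : E.Carrier → EV.Elt → List (E.Carrier × EV.Elt)
  φ₂₃φ₁₃ e ys = concatMap (φ₂₃φ₁₃-pure e) ys

  private
    p₂₃ = φ₂₃ K {E = E} {V} φ
    p₁₃ = φ₁₃ K {E = E} {V} φ
    f₁₃ = flip13 K {E = E} {V}

    f₁₃∘p₂₃-flipped : ∀ e xs → f₁₃ (p₂₃ (map (flipped e) xs)) ≡ concatMap (φ₁₃-pure e) xs
    f₁₃∘p₂₃-flipped e []             = refl
    f₁₃∘p₂₃-flipped e ((x , b) ∷ xs) = cong (map (flipped x) (φ [ (e , b) ]) ++_) (f₁₃∘p₂₃-flipped e xs)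

    p₂₃-flipped : ∀ x xs → p₂₃ (map (flipped x) xs) ≡ map (φ₂₃-flipped x) xs
    p₂₃-flipped x []       = refl
    p₂₃-flipped x (y ∷ xs) = cong (φ₂₃-flipped x y ∷_) (p₂₃-flipped x xs)

    p₂₃∘f₁₃∘p₂₃-flipped : ∀ e xs → p₂₃ (f₁₃ (p₂₃ (map (flipped e) xs))) ≡ concatMap (φ₂₃φ₁₃-pure e) xs
    p₂₃∘f₁₃∘p₂₃-flipped e []             = refl
    p₂₃∘f₁₃∘p₂₃-flipped e ((x , b) ∷ xs) =
      trans (concatMap-++ _ (map (flipped x) (φ [ (e , b) ])) (f₁₃ (p₂₃ (map (flipped e) xs))))
            (cong₂ _++_ (p₂₃-flipped x (φ [ (e , b) ])) (p₂₃∘f₁₃∘p₂₃-flipped e xs))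

  φ₁₃∘φ₂₃≡ : ∀ t → p₁₃ (p₂₃ t) ≡ concatMap (λ (e , ys) → φ₁₃φ₂₃ e ys) t
  φ₁₃∘φ₂₃≡ []             = refl
  φ₁₃∘φ₂₃≡ ((e , ys) ∷ t) = begin
    f₁₃ (p₂₃ (map (flipped e) (φ ys) ++ f₁₃ (p₂₃ t)))
      ≡⟨ cong f₁₃ (concatMap-++ _ (map (flipped e) (φ ys)) (f₁₃ (p₂₃ t))) ⟩
    f₁₃ (p₂₃ (map (flipped e) (φ ys)) ++ p₂₃ (f₁₃ (p₂₃ t)))
      ≡⟨ concatMap-++ _ (p₂₃ (map (flipped e) (φ ys))) (p₂₃ (f₁₃ (p₂₃ t))) ⟩
    f₁₃ (p₂₃ (map (flipped e) (φ ys))) ++ p₁₃ (p₂₃ t)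
      ≡⟨ cong₂ _++_ (f₁₃∘p₂₃-flipped e (φ ys)) (φ₁₃∘φ₂₃≡ t) ⟩
    φ₁₃φ₂₃ e ys ++ concatMap (λ (e , ys) → φ₁₃φ₂₃ e ys) t ∎
    where open ≡-Reasoning

  φ₂₃∘φ₁₃≡ : ∀ t → p₂₃ (p₁₃ t) ≡ concatMap (λ (e , ys) → φ₂₃φ₁₃ e ys) t
  φ₂₃∘φ₁₃≡ []             = refl
  φ₂₃∘φ₁₃≡ ((e , ys) ∷ t) = begin
    p₂₃ (f₁₃ (p₂₃ (map (flipped e) ys ++ f₁₃ t)))
      ≡⟨ cong (p₂₃ ∘ f₁₃) (concatMap-++ _ (map (flipped e) ys) (f₁₃ t)) ⟩
    p₂₃ (f₁₃ (p₂₃ (map (flipped e) ys) ++ p₂₃ (f₁₃ t)))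
      ≡⟨ cong p₂₃ (concatMap-++ _ (p₂₃ (map (flipped e) ys)) (p₂₃ (f₁₃ t))) ⟩
    p₂₃ (f₁₃ (p₂₃ (map (flipped e) ys)) ++ p₁₃ t)
      ≡⟨ concatMap-++ _ (f₁₃ (p₂₃ (map (flipped e) ys))) (p₁₃ t) ⟩
    p₂₃ (f₁₃ (p₂₃ (map (flipped e) ys))) ++ p₂₃ (p₁₃ t)
      ≡⟨ cong₂ _++_ (p₂₃∘f₁₃∘p₂₃-flipped e ys) (φ₂₃∘φ₁₃≡ t) ⟩
    φ₂₃φ₁₃ e ys ++ concatMap (λ (e , ys) → φ₂₃φ₁₃ e ys) t ∎
    where open ≡-Reasoning

  TreeCompatible⇒pure : TreeCompatible K E V φ → ∀ e ys → φ₁₃φ₂₃ e ys ≋ φ₂₃φ₁₃ e ys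
  TreeCompatible⇒pure tc e ys = begin
    φ₁₃φ₂₃ e ys           ≡⟨ ++-identityʳ (φ₁₃φ₂₃ e ys) ⟨
    φ₁₃φ₂₃ e ys ++ []      ≡⟨ φ₁₃∘φ₂₃≡ [ (e , ys) ] ⟨
    p₁₃ (p₂₃ [ (e , ys) ]) ≈⟨ tc [ (e , ys) ] ⟩
    p₂₃ (p₁₃ [ (e , ys) ]) ≡⟨ φ₂₃∘φ₁₃≡ [ (e , ys) ] ⟩
    φ₂₃φ₁₃ e ys ++ []      ≡⟨ ++-identityʳ (φ₂₃φ₁₃ e ys) ⟩
    φ₂₃φ₁₃ e ys           ∎
    where open EEV.≋-Reasoning

  pure⇒TreeCompatible : (∀ e ys → φ₁₃φ₂₃ e ys ≋ φ₂₃φ₁₃ e ys) → TreeCompatible K E V φ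
  pure⇒TreeCompatible pure t = begin
    p₁₃ (p₂₃ t)                                     ≡⟨ φ₁₃∘φ₂₃≡ t ⟩
    concatMap (λ (e , ys) → φ₁₃φ₂₃ e ys) t          ≈⟨ EEV.concatMap⁺ (λ (e , ys) → pure e ys) t ⟩
    concatMap (λ (e , ys) → φ₂₃φ₁₃ e ys) t          ≡⟨ φ₂₃∘φ₁₃≡ t ⟨
    p₂₃ (p₁₃ t)                                     ∎
    where open EEV.≋-Reasoning

module TensorProduct {r ℓr m ℓm} (K : CommutativeRing r ℓr) (DE DV DE' DV' : Module K m ℓm) where
  private
    module E = Module DE
    module V = Module DV
    module E' = Module DE'
    module V' = Module DV'

  E = toSpace K DE
  V = toSpace K DV
  E' = toSpace K DE'
  V' = toSpace K DV'
  EV = _⊗_ K E V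
  EV' = _⊗_ K E' V'
  EE = _⊗_ K E E'
  VV = _⊗_ K V V'
  W = _⊗_ K EE VV

  module EV = TensorRel K E V
  module EV' = TensorRel K E' V'
  module EE = TensorRel K E E'
  module VV = TensorRel K V V'
  module W = CommutativeListCongruenceProperties (⊗-congruence K EE VV)
  module W-rel = TensorRel K EE VV
  open W using (_≋_; ≋-sym; ≋-trans; ≡⇒≋)

  infixl 7 _·ᴱⱽ_ _·ᴱⱽ'_ _·ᵂ_
  _·ᴱⱽ_ = Space._·_ EV
  _·ᴱⱽ'_ = Space._·_ EV'
  _·ᵂ_ = Space._·_ W

  pair⊠ : E.Carrierᴹ × V.Carrierᴹ → E'.Carrierᴹ × V'.Carrierᴹ → EE.Elt × VV.Elt
  pair⊠ (p , q) (p' , q') = ([ (p , p') ] , [ (q , q') ])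

  infixl 7 _⊠_
  _⊠_ : EV.Elt → EV'.Elt → W-rel.Elt
  _⊠_ = productWith pair⊠

  ·-⊠ : ∀ c xs ys → c ·ᴱⱽ xs ⊠ ys ≡ c ·ᵂ (xs ⊠ ys)
  ·-⊠ c []             ys = refl
  ·-⊠ c ((p , q) ∷ xs) ys =
    trans (cong₂ _++_ (·-pair⊠ ys) (·-⊠ c xs ys)) (sym (map-++ _ (map (pair⊠ (p , q)) ys) (xs ⊠ ys)))
    where
    ·-pair⊠ : ∀ ys → map (pair⊠ (c E.*ₗ p , q)) ys ≡ c ·ᵂ map (pair⊠ (p , q)) ys
    ·-pair⊠ []       = refl
    ·-pair⊠ (y ∷ ys) = cong (pair⊠ (c E.*ₗ p , q) y ∷_) (·-pair⊠ ys)

  ·-⊠-mid : ∀ c xs ys → c ·ᴱⱽ xs ⊠ ys ≋ xs ⊠ (c ·ᴱⱽ' ys)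
  ·-⊠-mid c xs ys = ≋-trans (≡⇒≋ (concatMap-map (λ u → map (pair⊠ u) ys) _ xs))
    (W.concatMap⁺ (λ (p , q) → ≋-trans (W.map⁺ (λ (p' , q') → W-rel.pure-cong (EE.smul c p p') VV.∼-refl) ys)
                                         (≡⇒≋ (map-∘ ys))) xs)

  ⊠-congˡ : ∀ ys {xs xs'} → xs EV.∼ xs' → xs ⊠ ys ≋ xs' ⊠ ys
  ⊠-congˡ ys = concatMap-resp-∼ K E V (⊗-congruence K EE VV) balanced
    where
    balanced : Balanced K E V (⊗-congruence K EE VV) (λ u → map (pair⊠ u) ys)
    balanced = record
      { resp-≈ = λ p≈ q≈ → W.map⁺ (λ _ → W-rel.pure-cong (EE.pure-cong p≈ E'.≈ᴹ-refl) (VV.pure-cong q≈ V'.≈ᴹ-refl)) ys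
      ; +ˡ = λ p₁ p₂ q → W.map-distrib (λ (p' , _) →
          W-rel.∼-trans (W-rel.pure-cong (EE.addˡ p₁ p₂ p') VV.∼-refl) (W-rel.addˡ _ _ _)) ys
      ; +ʳ = λ p q₁ q₂ → W.map-distrib (λ (_ , q') →
          W-rel.∼-trans (W-rel.pure-cong EE.∼-refl (VV.addˡ q₁ q₂ q')) (W-rel.addʳ _ _ _)) ys
      ; ·-mid = λ c p q → W.map⁺ (λ (p' , q') → W-rel.smul c [ (p , p') ] [ (q , q') ]) ys
      ; 0ˡ = λ q → W.map-≋[] (λ (p' , _) →
          W-rel.∼-trans (W-rel.pure-cong (EE.zeroˡ p') VV.∼-refl) (W-rel.zeroˡ _)) ys
      }

  ⊠-congʳ : ∀ xs {ys ys'} → ys EV'.∼ ys' → xs ⊠ ys ≋ xs ⊠ ys'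
  ⊠-congʳ xs {ys} {ys'} ys∼ys' = W.concatMap⁺ (λ u → begin
      map (pair⊠ u) ys                  ≡⟨ map-as-concatMap (pair⊠ u) ys ⟩
      concatMap ([_] ∘ pair⊠ u) ys      ≈⟨ concatMap-resp-∼ K E' V' (⊗-congruence K EE VV) (balanced u) ys∼ys' ⟩
      concatMap ([_] ∘ pair⊠ u) ys'     ≡⟨ map-as-concatMap (pair⊠ u) ys' ⟨
      map (pair⊠ u) ys'                 ∎) xs
    where
    open W.≋-Reasoning
    balanced : ∀ u → Balanced K E' V' (⊗-congruence K EE VV) ([_] ∘ pair⊠ u)
    balanced (p , q) = record
      { resp-≈ = λ p'≈ q'≈ → W-rel.pure-cong (EE.pure-cong E.≈ᴹ-refl p'≈) (VV.pure-cong V.≈ᴹ-refl q'≈)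
      ; +ˡ = λ p₁ p₂ q' → W-rel.∼-trans (W-rel.pure-cong (EE.addʳ p p₁ p₂) VV.∼-refl) (W-rel.addˡ _ _ _)
      ; +ʳ = λ p' q₁ q₂ → W-rel.∼-trans (W-rel.pure-cong EE.∼-refl (VV.addʳ q q₁ q₂)) (W-rel.addʳ _ _ _)
      ; ·-mid = λ c p' q' → W-rel.∼-trans (W-rel.pure-cong (EE.∼-sym (EE.smul c p p')) VV.∼-refl)
          (W-rel.∼-trans (W-rel.smul c [ (p , p') ] [ (q , q') ]) (W-rel.pure-cong EE.∼-refl (VV.smul c q q')))
      ; 0ˡ = λ q' → W-rel.∼-trans (W-rel.pure-cong (ModuleTensor.⊗-zeroʳ K DE DE' p) VV.∼-refl) (W-rel.zeroˡ _)
      }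

  ⊠-splitˡ : ∀ {xs} xs₁ xs₂ ys → xs EV.∼ xs₁ ++ xs₂ → xs ⊠ ys ≋ xs₁ ⊠ ys ++ xs₂ ⊠ ys
  ⊠-splitˡ xs₁ xs₂ ys xs∼ = ≋-trans (⊠-congˡ ys xs∼) (≡⇒≋ (productWith-distribʳ-++ pair⊠ xs₁ xs₂ ys))

  ⊠-splitʳ : ∀ xs {ys} ys₁ ys₂ → ys EV'.∼ ys₁ ++ ys₂ → xs ⊠ ys ≋ xs ⊠ ys₁ ++ xs ⊠ ys₂
  ⊠-splitʳ xs ys₁ ys₂ ys∼ = ≋-trans (⊠-congʳ xs ys∼) (W.productWith-distribˡ-++ pair⊠ xs ys₁ ys₂)

  ⊠-·-transfer : ∀ c {xs xs₀ ys ys₀} → xs EV.∼ c ·ᴱⱽ xs₀ → ys EV'.∼ c ·ᴱⱽ' ys₀ → xs ⊠ ys₀ ≋ xs₀ ⊠ ys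
  ⊠-·-transfer c {xs₀ = xs₀} {ys₀ = ys₀} xs∼ ys∼ =
    ≋-trans (⊠-congˡ ys₀ xs∼) (≋-trans (·-⊠-mid c xs₀ ys₀) (≋-sym (⊠-congʳ xs₀ ys∼)))

module ProductMap {r ℓr m ℓm} (K : CommutativeRing r ℓr) (DE DV DE' DV' : Module K m ℓm)
  (φ : LinEnd K (_⊗_ K (toSpace K DE) (toSpace K DV)))
  (φ' : LinEnd K (_⊗_ K (toSpace K DE') (toSpace K DV'))) where
  private
    module E = Module DE
    module V = Module DV
    module E' = Module DE'
    module V' = Module DV'
  open TensorProduct K DE DV DE' DV'
  open W using (_≋_; ≋-refl; ≋-sym; ≋-trans; ≡⇒≋)
  module φ = ModuleTensor.OnPureTensors K DE DV φ
  module φ' = ModuleTensor.OnPureTensors K DE' DV' φ'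
  open φ public using (F)
  open φ' public using () renaming (F to F')

  Φ-pure : E.Carrierᴹ × E'.Carrierᴹ → V.Carrierᴹ × V'.Carrierᴹ → W-rel.Elt
  Φ-pure (a , a') (b , b') = F a b ⊠ F' a' b'

  Φ-row : VV.Elt → E.Carrierᴹ × E'.Carrierᴹ → W-rel.Elt
  Φ-row vs z = concatMap (Φ-pure z) vs

  Φ-gen : EE.Elt × VV.Elt → W-rel.Elt
  Φ-gen (es , vs) = concatMap (Φ-row vs) es

  Φ : W-rel.Elt → W-rel.Elt
  Φ = concatMap Φ-gen

  Φ-pure-resp-≈ : ∀ {a a' b b' c c' d d'} → a E.≈ᴹ c → a' E'.≈ᴹ c' → b V.≈ᴹ d → b' V'.≈ᴹ d' →
    Φ-pure (a , a') (b , b') ≋ Φ-pure (c , c') (d , d')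
  Φ-pure-resp-≈ {a' = a'} {b' = b'} {c = c} {d = d} a≈ a'≈ b≈ b'≈ =
    ≋-trans (⊠-congˡ (F' a' b') (φ.F-resp-≈ a≈ b≈)) (⊠-congʳ (F c d) (φ'.F-resp-≈ a'≈ b'≈))

  Φ-row-resp-∼ : ∀ z {vs vs'} → vs VV.∼ vs' → Φ-row vs z ≋ Φ-row vs' z
  Φ-row-resp-∼ (a , a') = concatMap-resp-∼ K V V' (⊗-congruence K EE VV) record
    { resp-≈ = Φ-pure-resp-≈ E.≈ᴹ-refl E'.≈ᴹ-refl
    ; +ˡ = λ b₁ b₂ b' → ⊠-splitˡ (F a b₁) (F a b₂) (F' a' b') (φ.F-+ʳ a b₁ b₂)
    ; +ʳ = λ b b₁ b₂ → ⊠-splitʳ (F a b) (F' a' b₁) (F' a' b₂) (φ'.F-+ʳ a' b₁ b₂)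
    ; ·-mid = λ c b b' → ⊠-·-transfer c (φ.F-·ʳ c a b) (φ'.F-·ʳ c a' b')
    ; 0ˡ = λ b' → ⊠-congˡ (F' a' b') (φ.F-0ʳ a)
    }

  Φ-gen-resp-∼ : ∀ vs {es es'} → es EE.∼ es' → concatMap (Φ-row vs) es ≋ concatMap (Φ-row vs) es'
  Φ-gen-resp-∼ vs = concatMap-resp-∼ K E E' (⊗-congruence K EE VV) record
    { resp-≈ = λ a≈ a'≈ → W.concatMap⁺ (λ _ → Φ-pure-resp-≈ a≈ a'≈ V.≈ᴹ-refl V'.≈ᴹ-refl) vs
    ; +ˡ = λ a₁ a₂ a' → W.concatMap-distrib (λ (b , b') → ⊠-splitˡ (F a₁ b) (F a₂ b) (F' a' b') (φ.F-+ˡ a₁ a₂ b)) vs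
    ; +ʳ = λ a a₁ a₂ → W.concatMap-distrib (λ (b , b') → ⊠-splitʳ (F a b) (F' a₁ b') (F' a₂ b') (φ'.F-+ˡ a₁ a₂ b')) vs
    ; ·-mid = λ c a a' → W.concatMap⁺ (λ (b , b') → ⊠-·-transfer c (φ.F-·ˡ c a b) (φ'.F-·ˡ c a' b')) vs
    ; 0ˡ = λ a' → W.concatMap-≋[] (λ (b , b') → ⊠-congˡ (F' a' b') (φ.F-0ˡ b)) vs
    }

  Φ-resp-∼ : ∀ {xs ys} → xs W-rel.∼ ys → Φ xs ≋ Φ ys
  Φ-resp-∼ = concatMap-resp-∼ K EE VV (⊗-congruence K EE VV) record
    { resp-≈ = λ {_} {es'} {vs} es∼ vs∼ → ≋-trans (Φ-gen-resp-∼ vs es∼) (W.concatMap⁺ (λ z → Φ-row-resp-∼ z vs∼) es')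
    ; +ˡ = λ es₁ es₂ vs → ≡⇒≋ (concatMap-++ (Φ-row vs) es₁ es₂)
    ; +ʳ = λ es vs₁ vs₂ → W.concatMap-distrib (λ z → ≡⇒≋ (concatMap-++ (Φ-pure z) vs₁ vs₂)) es
    ; ·-mid = λ c es vs → ≋-trans (≡⇒≋ (concatMap-map (Φ-row vs) _ es))
        (W.concatMap⁺ (λ (a , a') → ≋-trans
          (W.concatMap⁺ (λ (b , b') → ⊠-congˡ (F' a' b') (EV.∼-trans (φ.F-·ˡ c a b) (EV.∼-sym (φ.F-·ʳ c a b)))) vs)
          (≋-sym (≡⇒≋ (concatMap-map (Φ-pure (a , a')) _ vs)))) es)
    ; 0ˡ = λ _ → ≋-refl
    }

  concatMap-· : ∀ {ℓ ℓ'} {M : Space K m ℓ} {N : Space K m ℓ'} c (f : Space.Carrier M × Space.Carrier N → W-rel.Elt) →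
    (∀ p q → f (Space._·_ M c p , q) ≋ c ·ᵂ f (p , q)) →
    ∀ xs → concatMap f (Space._·_ (_⊗_ K M N) c xs) ≋ c ·ᵂ concatMap f xs
  concatMap-· c f f-· xs = ≋-trans (≡⇒≋ (concatMap-map f _ xs))
    (≋-trans (W.concatMap⁺ (λ (p , q) → f-· p q) xs) (≡⇒≋ (sym (map-concatMap _ f xs))))

  Φ-homog : ∀ c xs → Φ (c ·ᵂ xs) ≋ c ·ᵂ Φ xs
  Φ-homog c = concatMap-· {M = EE} {VV} c Φ-gen λ es vs → concatMap-· {M = E} {E'} c (Φ-row vs) (λ a a' →
    ≋-trans (W.concatMap⁺ (λ (b , b') →
               ≋-trans (⊠-congˡ (F' a' b') (φ.F-·ˡ c a b)) (≡⇒≋ (·-⊠ c (F a b) (F' a' b')))) vs)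
            (≡⇒≋ (sym (map-concatMap _ (Φ-pure (a , a')) vs)))) es

  Φ-linear : IsLinear K W Φ
  Φ-linear = record { cong = Φ-resp-∼ ; additive = λ xs ys → ≡⇒≋ (concatMap-++ Φ-gen xs ys) ; homog = Φ-homog }

module ProductTree {r ℓr m ℓm} (K : CommutativeRing r ℓr) (DE DV DE' DV' : Module K m ℓm)
  (φ : LinEnd K (_⊗_ K (toSpace K DE) (toSpace K DV)))
  (φ' : LinEnd K (_⊗_ K (toSpace K DE') (toSpace K DV'))) where
  private
    module K = CommutativeRing K
    module E = Module DE
    module V = Module DV
    module E' = Module DE'
    module V' = Module DV'
  open TensorProduct K DE DV DE' DV'
  open ProductMap K DE DV DE' DV' φ φ'
  module TΦ = TreeCompatibility K EE VV Φ
  module Tφ = TreeCompatibility K E V (LinEnd.fun φ)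
  module Tφ' = TreeCompatibility K E' V' (LinEnd.fun φ')
  module E-EV = TensorRel K E EV
  module E'-EV' = TensorRel K E' EV'
  module EE-W = TensorRel K EE W
  module EEW = CommutativeListCongruenceProperties (⊗-congruence K EE W)
  open EEW using (_≋_; ≋-sym; ≋-trans; ≡⇒≋; concatMap⁺; concatMap-comm)

  pair⊠₃ : E.Carrierᴹ × EV.Elt → E'.Carrierᴹ × EV'.Elt → EE.Elt × W-rel.Elt
  pair⊠₃ (x , xs) (x' , xs') = ([ (x , x') ] , xs ⊠ xs')

  infixl 7 _⊠₃_
  _⊠₃_ : E-EV.Elt → E'-EV'.Elt → EE-W.Elt
  _⊠₃_ = productWith pair⊠₃

  ⊠₃-congˡ : ∀ Y {X X'} → X E-EV.∼ X' → X ⊠₃ Y ≋ X' ⊠₃ Y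
  ⊠₃-congˡ Y = concatMap-resp-∼ K E EV (⊗-congruence K EE W) record
    { resp-≈ = λ x≈ xs∼ → EEW.map⁺ (λ (_ , xs') → EE-W.pure-cong (EE.pure-cong x≈ E'.≈ᴹ-refl) (⊠-congˡ xs' xs∼)) Y
    ; +ˡ = λ x₁ x₂ xs → EEW.map-distrib (λ (x' , _) →
        EE-W.∼-trans (EE-W.pure-cong (EE.addˡ x₁ x₂ x') W-rel.∼-refl) (EE-W.addˡ _ _ _)) Y
    ; +ʳ = λ x xs₁ xs₂ → EEW.map-distrib (λ (_ , xs') → EE-W.∼-trans
        (EE-W.pure-cong EE.∼-refl (W.≡⇒≋ (productWith-distribʳ-++ pair⊠ xs₁ xs₂ xs'))) (EE-W.addʳ _ _ _)) Y
    ; ·-mid = λ c x xs → EEW.map⁺ (λ (x' , xs') → EE-W.∼-trans (EE-W.smul c [ (x , x') ] (xs ⊠ xs'))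
        (EE-W.pure-cong EE.∼-refl (W.≡⇒≋ (sym (·-⊠ c xs xs'))))) Y
    ; 0ˡ = λ xs → EEW.map-≋[] (λ (x' , _) →
        EE-W.∼-trans (EE-W.pure-cong (EE.zeroˡ x') W-rel.∼-refl) (EE-W.zeroˡ _)) Y
    }

  ⊠₃-congʳ : ∀ X {Y Y'} → Y E'-EV'.∼ Y' → X ⊠₃ Y ≋ X ⊠₃ Y'
  ⊠₃-congʳ X {Y} {Y'} Y∼Y' = concatMap⁺ (λ u → begin
      map (pair⊠₃ u) Y                ≡⟨ map-as-concatMap (pair⊠₃ u) Y ⟩
      concatMap ([_] ∘ pair⊠₃ u) Y    ≈⟨ concatMap-resp-∼ K E' EV' (⊗-congruence K EE W) (balanced u) Y∼Y' ⟩
      concatMap ([_] ∘ pair⊠₃ u) Y'   ≡⟨ map-as-concatMap (pair⊠₃ u) Y' ⟨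
      map (pair⊠₃ u) Y'               ∎) X
    where
    open EEW.≋-Reasoning
    balanced : ∀ u → Balanced K E' EV' (⊗-congruence K EE W) ([_] ∘ pair⊠₃ u)
    balanced (x , xs) = record
      { resp-≈ = λ x'≈ xs'∼ → EE-W.pure-cong (EE.pure-cong E.≈ᴹ-refl x'≈) (⊠-congʳ xs xs'∼)
      ; +ˡ = λ x₁ x₂ xs' → EE-W.∼-trans (EE-W.pure-cong (EE.addʳ x x₁ x₂) W-rel.∼-refl) (EE-W.addˡ _ _ _)
      ; +ʳ = λ x' xs₁ xs₂ → EE-W.∼-trans
          (EE-W.pure-cong EE.∼-refl (W.productWith-distribˡ-++ pair⊠ xs xs₁ xs₂)) (EE-W.addʳ _ _ _)
      ; ·-mid = λ c x' xs' → EE-W.∼-trans (EE-W.pure-cong (EE.∼-sym (EE.smul c x x')) W-rel.∼-refl)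
          (EE-W.∼-trans (EE-W.smul c [ (x , x') ] (xs ⊠ xs'))
            (EE-W.pure-cong EE.∼-refl (W.≋-trans (W.≡⇒≋ (sym (·-⊠ c xs xs'))) (·-⊠-mid c xs xs'))))
      ; 0ˡ = λ xs' → EE-W.∼-trans (EE-W.pure-cong (ModuleTensor.⊗-zeroʳ K DE DE' x) W-rel.∼-refl) (EE-W.zeroˡ _)
      }

  pair-concatMapʳ : ∀ {b} {B : Set b} x (g : B → W-rel.Elt) zs →
    [ (x , concatMap g zs) ] ≋ concatMap (λ z → [ (x , g z) ]) zs
  pair-concatMapʳ x g []       = EE-W.∼-trans (EE-W.∼-sym (EE-W.smul K.0# x []))
    (EE-W.∼-trans (EE-W.pure-cong (ModuleTensor.·-zeroˡ K DE DE' x) W-rel.∼-refl) (EE-W.zeroˡ []))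
  pair-concatMapʳ x g (z ∷ zs) =
    EE-W.∼-trans (EE-W.addʳ x (g z) (concatMap g zs)) (EE-W.++-cong EE-W.∼-refl (pair-concatMapʳ x g zs))

  Φ-pureᵛ : ∀ e b b' → Φ [ (e , [ (b , b') ]) ] ≡ concatMap (λ α → Φ-pure α (b , b')) e
  Φ-pureᵛ e b b' = trans (++-identityʳ _) (concatMap-cong (λ α → ++-identityʳ (Φ-pure α (b , b'))) e)

  φ₁₃-pure-⊠ : ∀ e u u' →
    TΦ.φ₁₃-pure e (pair⊠ u u') ≡ concatMap (λ (a , a') → Tφ.φ₁₃-pure a u ⊠₃ Tφ'.φ₁₃-pure a' u') e
  φ₁₃-pure-⊠ e (x , b) (x' , b') = begin
    map flipped (Φ [ (e , [ (b , b') ]) ])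
      ≡⟨ cong (map flipped) (Φ-pureᵛ e b b') ⟩
    map flipped (concatMap (λ α → Φ-pure α (b , b')) e)
      ≡⟨ map-concatMap flipped _ e ⟩
    concatMap (λ (a , a') → map flipped (F a b ⊠ F' a' b')) e
      ≡⟨ concatMap-cong (λ (a , a') → trans (map-productWith flipped pair⊠ (F a b) (F' a' b'))
           (sym (productWith-map pair⊠₃ (Tφ.flipped x) (Tφ'.flipped x') (F a b) (F' a' b')))) e ⟩
    concatMap (λ (a , a') → Tφ.φ₁₃-pure a (x , b) ⊠₃ Tφ'.φ₁₃-pure a' (x' , b')) e ∎
    where
    open ≡-Reasoning
    flipped = TΦ.flipped [ (x , x') ]

  concatMap-φ₁₃-pure-⊠ : ∀ e xs xs' → concatMap (TΦ.φ₁₃-pure e) (xs ⊠ xs') ≋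
    concatMap (λ (a , a') → concatMap (Tφ.φ₁₃-pure a) xs ⊠₃ concatMap (Tφ'.φ₁₃-pure a') xs') e
  concatMap-φ₁₃-pure-⊠ e xs xs' = begin
    concatMap (TΦ.φ₁₃-pure e) (xs ⊠ xs')
      ≡⟨ concatMap-productWith (TΦ.φ₁₃-pure e) pair⊠ xs xs' ⟩
    concatMap (λ u → concatMap (λ u' → TΦ.φ₁₃-pure e (pair⊠ u u')) xs') xs
      ≡⟨ concatMap-cong (λ u → concatMap-cong (φ₁₃-pure-⊠ e u) xs') xs ⟩
    concatMap (λ u → concatMap (λ u' → concatMap (λ α → term α u u') e) xs') xs
      ≈⟨ concatMap⁺ (λ u → concatMap-comm (λ u' α → term α u u') xs' e) xs ⟩
    concatMap (λ u → concatMap (λ α → concatMap (term α u) xs') e) xs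
      ≈⟨ concatMap-comm (λ u α → concatMap (term α u) xs') xs e ⟩
    concatMap (λ α → concatMap (λ u → concatMap (term α u) xs') xs) e
      ≈⟨ ≋-sym (concatMap⁺ (λ (a , a') →
           EEW.productWith-concatMap pair⊠₃ (Tφ.φ₁₃-pure a) (Tφ'.φ₁₃-pure a') xs xs') e) ⟩
    concatMap (λ (a , a') → concatMap (Tφ.φ₁₃-pure a) xs ⊠₃ concatMap (Tφ'.φ₁₃-pure a') xs') e ∎
    where
    open EEW.≋-Reasoning
    term : E.Carrierᴹ × E'.Carrierᴹ → E.Carrierᴹ × V.Carrierᴹ → E'.Carrierᴹ × V'.Carrierᴹ → EE-W.Elt
    term (a , a') u u' = Tφ.φ₁₃-pure a u ⊠₃ Tφ'.φ₁₃-pure a' u'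

  map-φ₂₃-flipped-⊠ : ∀ e₂ xs xs' → map (TΦ.φ₂₃-flipped e₂) (xs ⊠ xs') ≋
    concatMap (λ (a₂ , a₂') → map (Tφ.φ₂₃-flipped a₂) xs ⊠₃ map (Tφ'.φ₂₃-flipped a₂') xs') e₂
  map-φ₂₃-flipped-⊠ e₂ xs xs' = begin
    map (TΦ.φ₂₃-flipped e₂) (xs ⊠ xs')
      ≡⟨ map-productWith (TΦ.φ₂₃-flipped e₂) pair⊠ xs xs' ⟩
    productWith (λ u u' → TΦ.φ₂₃-flipped e₂ (pair⊠ u u')) xs xs'
      ≈⟨ EEW.productWith-split _ term e₂ split xs xs' ⟩
    concatMap (λ γ → productWith (term γ) xs xs') e₂
      ≡⟨ concatMap-cong (λ (a₂ , a₂') →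
           productWith-map pair⊠₃ (Tφ.φ₂₃-flipped a₂) (Tφ'.φ₂₃-flipped a₂') xs xs') e₂ ⟨
    concatMap (λ (a₂ , a₂') → map (Tφ.φ₂₃-flipped a₂) xs ⊠₃ map (Tφ'.φ₂₃-flipped a₂') xs') e₂ ∎
    where
    open EEW.≋-Reasoning
    term : E.Carrierᴹ × E'.Carrierᴹ → E.Carrierᴹ × V.Carrierᴹ → E'.Carrierᴹ × V'.Carrierᴹ → EE.Elt × W-rel.Elt
    term (a₂ , a₂') u u' = pair⊠₃ (Tφ.φ₂₃-flipped a₂ u) (Tφ'.φ₂₃-flipped a₂' u')
    split : ∀ u u' → [ TΦ.φ₂₃-flipped e₂ (pair⊠ u u') ] ≋ concatMap (λ γ → [ term γ u u' ]) e₂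
    split (x , b) (x' , b') = ≋-trans (≡⇒≋ (cong (λ t → [ ([ (x , x') ] , t) ]) (Φ-pureᵛ e₂ b b')))
      (pair-concatMapʳ [ (x , x') ] (λ γ → Φ-pure γ (b , b')) e₂)

  expansion : (E.Carrierᴹ → EV.Elt → E-EV.Elt) → (E'.Carrierᴹ → EV'.Elt → E'-EV'.Elt) →
              EE.Elt → W-rel.Elt → EE-W.Elt
  expansion S S' e = concatMap λ (e₂ , w) → concatMap (λ (a₂ , a₂') → concatMap (λ (b , b') →
    concatMap (λ (a , a') → S a [ (a₂ , b) ] ⊠₃ S' a' [ (a₂' , b') ]) e) w) e₂

  expansion-cong : ∀ {S T S' T'} → (∀ a xs → S a xs E-EV.∼ T a xs) → (∀ a' xs' → S' a' xs' E'-EV'.∼ T' a' xs') →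
    ∀ e ys → expansion S S' e ys ≋ expansion T T' e ys
  expansion-cong {S} {T} {S'} {T'} S∼T S'∼T' e = concatMap⁺ λ (e₂ , w) → concatMap⁺ (λ (a₂ , a₂') →
    concatMap⁺ (λ (b , b') → concatMap⁺ (λ (a , a') →
      ≋-trans (⊠₃-congˡ (S' a' [ (a₂' , b') ]) (S∼T a [ (a₂ , b) ]))
              (⊠₃-congʳ (T a [ (a₂ , b) ]) (S'∼T' a' [ (a₂' , b') ]))) e) w) e₂

  φ₁₃φ₂₃-expansion : ∀ e ys → TΦ.φ₁₃φ₂₃ e ys ≋ expansion Tφ.φ₁₃φ₂₃ Tφ'.φ₁₃φ₂₃ e ys
  φ₁₃φ₂₃-expansion e ys = begin
    concatMap (TΦ.φ₁₃-pure e) (Φ ys)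
      ≡⟨ concatMap-Φ ys ⟩
    concatMap (λ (e₂ , w) → concatMap (λ γ → concatMap (λ β → concatMap (TΦ.φ₁₃-pure e) (Φ-pure γ β)) w) e₂) ys
      ≈⟨ concatMap⁺ (λ (e₂ , w) → concatMap⁺ (λ (a₂ , a₂') → concatMap⁺ (λ (b , b') →
           concatMap-φ₁₃-pure-⊠ e (F a₂ b) (F' a₂' b')) w) e₂) ys ⟩
    expansion Tφ.φ₁₃φ₂₃ Tφ'.φ₁₃φ₂₃ e ys ∎
    where
    open EEW.≋-Reasoning
    concatMap-Φ : ∀ ys → concatMap (TΦ.φ₁₃-pure e) (Φ ys) ≡
      concatMap (λ (e₂ , w) → concatMap (λ γ → concatMap (λ β → concatMap (TΦ.φ₁₃-pure e) (Φ-pure γ β)) w) e₂) ys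
    concatMap-Φ ys = trans (concatMap-concatMap _ Φ-gen ys) (concatMap-cong (λ (e₂ , w) →
      trans (concatMap-concatMap _ (Φ-row w) e₂) (concatMap-cong (λ γ → concatMap-concatMap _ (Φ-pure γ) w) e₂)) ys)

  φ₂₃φ₁₃-expansion : ∀ e ys → TΦ.φ₂₃φ₁₃ e ys ≋ expansion Tφ.φ₂₃φ₁₃ Tφ'.φ₂₃φ₁₃ e ys
  φ₂₃φ₁₃-expansion e = concatMap⁺ λ (e₂ , w) → begin
    map (TΦ.φ₂₃-flipped e₂) (Φ [ (e , w) ])
      ≡⟨ cong (map (TΦ.φ₂₃-flipped e₂)) (++-identityʳ (Φ-gen (e , w))) ⟩
    map (TΦ.φ₂₃-flipped e₂) (concatMap (Φ-row w) e)
      ≡⟨ trans (map-concatMap _ (Φ-row w) e) (concatMap-cong (λ α → map-concatMap _ (Φ-pure α) w) e) ⟩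
    concatMap (λ α → concatMap (λ β → map (TΦ.φ₂₃-flipped e₂) (Φ-pure α β)) w) e
      ≈⟨ concatMap⁺ (λ (a , a') → concatMap⁺ (λ (b , b') → map-φ₂₃-flipped-⊠ e₂ (F a b) (F' a' b')) w) e ⟩
    concatMap (λ α → concatMap (λ β → concatMap (term α β) e₂) w) e
      ≈⟨ concatMap⁺ (λ α → concatMap-comm (term α) w e₂) e ⟩
    concatMap (λ α → concatMap (λ γ → concatMap (λ β → term α β γ) w) e₂) e
      ≈⟨ concatMap-comm (λ α γ → concatMap (λ β → term α β γ) w) e e₂ ⟩
    concatMap (λ γ → concatMap (λ α → concatMap (λ β → term α β γ) w) e) e₂
      ≈⟨ concatMap⁺ (λ γ → concatMap-comm (λ α β → term α β γ) e w) e₂ ⟩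
    concatMap (λ γ → concatMap (λ β → concatMap (λ α → term α β γ) e) w) e₂
      ≡⟨ concatMap-cong (λ (a₂ , a₂') → concatMap-cong (λ (b , b') → concatMap-cong (λ (a , a') →
           cong₂ _⊠₃_ (++-identityʳ (map (Tφ.φ₂₃-flipped a₂) (F a b)))
                      (++-identityʳ (map (Tφ'.φ₂₃-flipped a₂') (F' a' b')))) e) w) e₂ ⟨
    concatMap (λ (a₂ , a₂') → concatMap (λ (b , b') → concatMap (λ (a , a') →
      Tφ.φ₂₃φ₁₃ a [ (a₂ , b) ] ⊠₃ Tφ'.φ₂₃φ₁₃ a' [ (a₂' , b') ]) e) w) e₂ ∎
    where
    open EEW.≋-Reasoning
    term : E.Carrierᴹ × E'.Carrierᴹ → V.Carrierᴹ × V'.Carrierᴹ → E.Carrierᴹ × E'.Carrierᴹ → EE-W.Elt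
    term (a , a') (b , b') (a₂ , a₂') = map (Tφ.φ₂₃-flipped a₂) (F a b) ⊠₃ map (Tφ'.φ₂₃-flipped a₂') (F' a' b')

  Φ-treeCompatible : TreeCompatible K E V (LinEnd.fun φ) → TreeCompatible K E' V' (LinEnd.fun φ') →
    TreeCompatible K EE VV Φ
  Φ-treeCompatible tc tc' = TΦ.pure⇒TreeCompatible λ e ys → begin
    TΦ.φ₁₃φ₂₃ e ys
      ≈⟨ φ₁₃φ₂₃-expansion e ys ⟩
    expansion Tφ.φ₁₃φ₂₃ Tφ'.φ₁₃φ₂₃ e ys
      ≈⟨ expansion-cong (Tφ.TreeCompatible⇒pure tc) (Tφ'.TreeCompatible⇒pure tc') e ys ⟩
    expansion Tφ.φ₂₃φ₁₃ Tφ'.φ₂₃φ₁₃ e ys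
      ≈⟨ φ₂₃φ₁₃-expansion e ys ⟨
    TΦ.φ₂₃φ₁₃ e ys ∎
    where open EEW.≋-Reasoning

proposition2p5 : ∀ {r ℓr m ℓm} (K : CommutativeRing r ℓr) → IsFieldChar0 K →
    (DE DV DE' DV' : Module K m ℓm) →
    (φ : LinEnd K (_⊗_ K (toSpace K DE) (toSpace K DV))) →
    (φ' : LinEnd K (_⊗_ K (toSpace K DE') (toSpace K DV'))) →
    TreeCompatible K (toSpace K DE) (toSpace K DV) (LinEnd.fun φ) →
    TreeCompatible K (toSpace K DE') (toSpace K DV') (LinEnd.fun φ') →
    IsLinear K (_⊗_ K (_⊗_ K (toSpace K DE) (toSpace K DE')) (_⊗_ K (toSpace K DV) (toSpace K DV')))
        (ΦFun K φ φ')
      × TreeCompatible K (_⊗_ K (toSpace K DE) (toSpace K DE')) (_⊗_ K (toSpace K DV) (toSpace K DV'))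
        (ΦFun K φ φ')
proposition2p5 K _ DE DV DE' DV' φ φ' tc tc' =
  ProductMap.Φ-linear K DE DV DE' DV' φ φ' , ProductTree.Φ-treeCompatible K DE DV DE' DV' φ φ' tc tc'
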